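{- Let $\mathcal{L}=\{\prec\}$ with $\prec$ a binary relation symbol, let $T$ be a first-order $\mathcal{L}$-theory, let $\mathbb{K}=\operatorname{Mod}(T)$, and let $\mathbb{K}_{sep}\subseteq\mathbb{K}$ be the class of those $\mathcal{M}\in\mathbb{K}$ satisfying Separability. Then $\mathbb{K}_{sep}$ is unfalsifiable relative to $\mathbb{K}$; that is, for every universal $\mathcal{L}$-sentence $\varphi$, $\mathbb{K}_{sep}\models\varphi$ if and only if $\mathbb{K}\models\varphi$.
   Context: An $\mathcal{L}$-structure $\mathcal{M}$ with domain $X$ satisfies Separability if there is a countable set $Z\subseteq X$ such that for all $x,y\in X$ there is $z\in Z$ with ($x\prec y \rightarrow (x\preceq z \wedge z\preceq y)$), where $u\preceq w$ abbreviates $u\prec w \vee u=w$. For classes $\mathbb{K}'\subseteq\mathbb{K}$, $\mathbb{K}'$ is falsifiable relative to $\mathbb{K}$ if the inclusion $\forall_1(\mathbb{K})\subseteq\forall_1(\mathbb{K}')$ is proper, where $\forall_1(\mathbb{C})$ denotes the set of universal first-order sentences true in every member of $\mathbb{C}$. -}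

module Defs where

open import Data.Nat using (ℕ; zero; suc)
open import Data.Fin using (Fin)
open import Data.Maybe using (Maybe; just)
open import Data.Product using (Σ; _×_; ∃)
open import Data.Sum using (_⊎_)
open import Data.Empty using (⊥)
open import Data.Unit using (⊤)
open import Relation.Nullary using (¬_)
open import Relation.Binary.PropositionalEquality using (_≡_)

-- Syntax of first-order logic (with equality) over L = {≺}.
-- L has no function or constant symbols, so terms are variables.
-- Formula n : formulas with free variables among Fin n (de Bruijn).

data Formula : ℕ → Set where
  rel   : ∀ {n} → Fin n → Fin n → Formula n
  eq    : ∀ {n} → Fin n → Fin n → Formula n
  falsum : ∀ {n} → Formula n
  verum  : ∀ {n} → Formula n
  neg   : ∀ {n} → Formula n → Formula n
  conj  : ∀ {n} → Formula n → Formula n → Formula n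
  disj  : ∀ {n} → Formula n → Formula n → Formula n
  impl  : ∀ {n} → Formula n → Formula n → Formula n
  all   : ∀ {n} → Formula (suc n) → Formula n
  ex    : ∀ {n} → Formula (suc n) → Formula n

Sentence : Set
Sentence = Formula 0

data QF : ∀ {n} → Formula n → Set where
  qf-rel    : ∀ {n} (i j : Fin n) → QF (rel i j)
  qf-eq     : ∀ {n} (i j : Fin n) → QF (eq i j)
  qf-falsum : ∀ {n} → QF (falsum {n})
  qf-verum  : ∀ {n} → QF (verum {n})
  qf-neg    : ∀ {n} {φ : Formula n} → QF φ → QF (neg φ)
  qf-conj   : ∀ {n} {φ ψ : Formula n} → QF φ → QF ψ → QF (conj φ ψ)
  qf-disj   : ∀ {n} {φ ψ : Formula n} → QF φ → QF ψ → QF (disj φ ψ)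
  qf-impl   : ∀ {n} {φ ψ : Formula n} → QF φ → QF ψ → QF (impl φ ψ)

data Universal : ∀ {n} → Formula n → Set where
  univ-qf  : ∀ {n} {φ : Formula n} → QF φ → Universal φ
  univ-all : ∀ {n} {φ : Formula (suc n)} → Universal φ → Universal (all φ)

record Structure : Set₁ where
  field
    Carrier : Set
    _≺_     : Carrier → Carrier → Set

open Structure public

extend : ∀ {A : Set} {n} → (Fin n → A) → A → Fin (suc n) → A
extend ρ a Fin.zero    = a
extend ρ a (Fin.suc i) = ρ i

Sat : (M : Structure) → ∀ {n} → (Fin n → Carrier M) → Formula n → Set
Sat M ρ (rel i j)  = _≺_ M (ρ i) (ρ j)
Sat M ρ (eq i j)   = ρ i ≡ ρ j
Sat M ρ falsum     = ⊥
Sat M ρ verum      = ⊤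
Sat M ρ (neg φ)    = ¬ Sat M ρ φ
Sat M ρ (conj φ ψ) = Sat M ρ φ × Sat M ρ ψ
Sat M ρ (disj φ ψ) = Sat M ρ φ ⊎ Sat M ρ ψ
Sat M ρ (impl φ ψ) = Sat M ρ φ → Sat M ρ ψ
Sat M ρ (all φ)    = (a : Carrier M) → Sat M (extend ρ a) φ
Sat M ρ (ex φ)     = Σ (Carrier M) λ a → Sat M (extend ρ a) φ

noVars : ∀ {A : Set} → Fin 0 → A
noVars ()

_⊨_ : Structure → Sentence → Set
M ⊨ φ = Sat M noVars φ

Theory : Set₁
Theory = Sentence → Set

Mod : Theory → Structure → Set
Mod T M = (φ : Sentence) → T φ → M ⊨ φ

-- A subset Z ⊆ A is countable: some f : ℕ → Maybe A enumerates all
-- of Z (i.e. Z injects into ℕ; finite and empty Z allowed).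
Countable : {A : Set} → (A → Set) → Set
Countable {A} Z = Σ (ℕ → Maybe A) λ f → (a : A) → Z a → ∃ λ n → f n ≡ just a

_⊢_⪯_ : (M : Structure) → Carrier M → Carrier M → Set
M ⊢ u ⪯ w = _≺_ M u w ⊎ u ≡ w

Separable : Structure → Set₁
Separable M =
  Σ (Carrier M → Set) λ Z →
    Countable Z ×
    ((x y : Carrier M) →
      Σ (Carrier M) λ z → Z z × (_≺_ M x y → (M ⊢ x ⪯ z) × (M ⊢ z ⪯ y)))

ExcludedMiddle : Set₁
ExcludedMiddle = (P : Set) → P ⊎ ¬ P

{-# OPTIONS --safe #-}
-- Every structure has a countable elementary substructure (downward
-- Löwenheim–Skolem: close a point under Skolem functions, chosen by excluded
-- middle, and check the Tarski–Vaught criterion), and a structure with a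
-- countable domain is trivially separable: take Z to be the whole domain and
-- z = x.  Hence a sentence failing in some model of T already fails in a
-- separable one.
module Submission where

open import Defs
open import Data.Bool.Properties using (T-irrelevant)
open import Data.Empty using (⊥-elim)
open import Data.Fin using (Fin)
open import Data.Maybe using (Maybe; just; nothing; zipWith; _>>=_)
import Data.Maybe as Maybe
open import Data.Nat using (ℕ; zero; suc)
open import Data.Nat.Binary using (ℕᵇ; 2[1+_]; 1+[2_]; toℕ) renaming (zero to 0ᵇ)
open import Data.Nat.Binary.Properties using (toℕ-injective; 2[1+_]-injective; 1+[2_]-injective)
open import Data.Product using (Σ; _×_; _,_; proj₁; proj₂; ∃)
open import Data.Product.Function.NonDependent.Propositional using (_×-⇔_)
open import Data.Product.Properties using (Σ-≡,≡→≡)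
open import Data.Sum using (_⊎_; inj₁; inj₂; [_,_]′)
open import Data.Sum.Function.Propositional using (_⊎-⇔_)
open import Data.Unit using (⊤; tt)
open import Function using (_∘_; id)
open import Function.Bundles using (_⇔_; mk⇔; Equivalence)
open import Function.Construct.Composition using (_⇔-∘_)
open import Function.Construct.Identity using (⇔-id)
open import Function.Definitions using (Injective)
open import Function.Related.TypeIsomorphisms using (¬-cong-⇔; →-cong-⇔)
open import Relation.Binary.PropositionalEquality
open import Relation.Nullary using (¬_; Dec; yes; no; Irrelevant)
open import Relation.Nullary.Decidable using (True; toWitness; fromWitness; fromSum; dec⇒maybe)

open Equivalence using (to; from)

extend-cong : {A : Set} {n : ℕ} {σ τ : Fin n → A} {a b : A} →
  (∀ i → σ i ≡ τ i) → a ≡ b → ∀ i → extend σ a i ≡ extend τ b i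
extend-cong σ≗τ a≡b Fin.zero    = a≡b
extend-cong σ≗τ a≡b (Fin.suc i) = σ≗τ i

extend-∘ : {A B : Set} {n : ℕ} (f : A → B) (σ : Fin n → A) (a : A) →
  ∀ i → f (extend σ a i) ≡ extend (f ∘ σ) (f a) i
extend-∘ f σ a Fin.zero    = refl
extend-∘ f σ a (Fin.suc i) = refl

Sat-cong : (M : Structure) {n : ℕ} (χ : Formula n) {σ τ : Fin n → Carrier M} →
  (∀ i → σ i ≡ τ i) → Sat M σ χ ⇔ Sat M τ χ
Sat-cong M (rel i j) e =
  mk⇔ (subst₂ (_≺_ M) (e i) (e j)) (subst₂ (_≺_ M) (sym (e i)) (sym (e j)))
Sat-cong M (eq i j) e =
  mk⇔ (λ p → trans (sym (e i)) (trans p (e j))) (λ p → trans (e i) (trans p (sym (e j))))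
Sat-cong M falsum     e = ⇔-id _
Sat-cong M verum      e = ⇔-id _
Sat-cong M (neg χ)    e = ¬-cong-⇔ (Sat-cong M χ e)
Sat-cong M (conj χ ψ) e = Sat-cong M χ e ×-⇔ Sat-cong M ψ e
Sat-cong M (disj χ ψ) e = Sat-cong M χ e ⊎-⇔ Sat-cong M ψ e
Sat-cong M (impl χ ψ) e = →-cong-⇔ (Sat-cong M χ e) (Sat-cong M ψ e)
Sat-cong M (all χ)    e = mk⇔ (λ h a → to (cong-at a) (h a)) (λ h a → from (cong-at a) (h a))
  where cong-at = λ a → Sat-cong M χ (extend-cong e (refl {x = a}))
Sat-cong M (ex χ)     e = mk⇔ (λ (a , s) → a , to (cong-at a) s) (λ (a , s) → a , from (cong-at a) s)
  where cong-at = λ a → Sat-cong M χ (extend-cong e (refl {x = a}))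

_≡ₑ_ : Structure → Structure → Set
M ≡ₑ N = (φ : Sentence) → M ⊨ φ ⇔ N ⊨ φ

decide : ExcludedMiddle → (P : Set) → Dec P
decide LEM P = fromSum (LEM P)

byContradiction : ExcludedMiddle → {P : Set} → ¬ ¬ P → P
byContradiction LEM {P} ¬¬p = [ id , ⊥-elim ∘ ¬¬p ]′ (LEM P)

hilbertε : ExcludedMiddle → {A : Set} → A → (P : A → Set) → Σ A λ a → Σ A P → P a
hilbertε LEM default P with LEM (Σ _ P)
... | inj₁ (a , p) = a , λ _ → p
... | inj₂ ¬∃P     = default , ⊥-elim ∘ ¬∃P

induced : (M : Structure) → (Carrier M → Set) → Structure
induced M P = record { Carrier = Σ (Carrier M) P ; _≺_ = λ x y → _≺_ M (proj₁ x) (proj₁ y) }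

TarskiVaught : (M : Structure) → (Carrier M → Set) → Set
TarskiVaught M P = ∀ {n} (ψ : Formula (suc n)) (ρ : Fin n → Σ (Carrier M) P) →
  Σ (Carrier M) (λ a → Sat M (extend (proj₁ ∘ ρ) a) ψ) →
  Σ (Σ (Carrier M) P) (λ w → Sat M (extend (proj₁ ∘ ρ) (proj₁ w)) ψ)

module _ (LEM : ExcludedMiddle) {M : Structure} {P : Carrier M → Set}
         (P-irrelevant : ∀ {a} → Irrelevant (P a)) (witness : TarskiVaught M P) where

  private
    N = induced M P

  Sat-induced : ∀ {n} (χ : Formula n) (ρ : Fin n → Carrier N) →
    Sat N ρ χ ⇔ Sat M (proj₁ ∘ ρ) χ
  Sat-induced-extend : ∀ {n} (χ : Formula (suc n)) (ρ : Fin n → Carrier N) (w : Carrier N) →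
    Sat N (extend ρ w) χ ⇔ Sat M (extend (proj₁ ∘ ρ) (proj₁ w)) χ

  Sat-induced-extend χ ρ w = Sat-cong M χ (extend-∘ proj₁ ρ w) ⇔-∘ Sat-induced χ (extend ρ w)

  Sat-induced (rel i j)  ρ = ⇔-id _
  Sat-induced (eq i j)   ρ =
    mk⇔ (cong proj₁) (λ p → Σ-≡,≡→≡ (p , P-irrelevant _ _))
  Sat-induced falsum     ρ = ⇔-id _
  Sat-induced verum      ρ = ⇔-id _
  Sat-induced (neg χ)    ρ = ¬-cong-⇔ (Sat-induced χ ρ)
  Sat-induced (conj χ ψ) ρ = Sat-induced χ ρ ×-⇔ Sat-induced ψ ρ
  Sat-induced (disj χ ψ) ρ = Sat-induced χ ρ ⊎-⇔ Sat-induced ψ ρ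
  Sat-induced (impl χ ψ) ρ = →-cong-⇔ (Sat-induced χ ρ) (Sat-induced ψ ρ)
  Sat-induced (all ψ)    ρ = mk⇔ downward (λ h w → from (Sat-induced-extend ψ ρ w) (h (proj₁ w)))
    where
    -- A counterexample in M yields one in N: apply the criterion to neg ψ.
    downward : Sat N ρ (all ψ) → Sat M (proj₁ ∘ ρ) (all ψ)
    downward h a = byContradiction LEM λ ¬ψa →
      let (w , ¬ψw) = witness (neg ψ) ρ (a , ¬ψa) in ¬ψw (to (Sat-induced-extend ψ ρ w) (h w))
  Sat-induced (ex ψ)     ρ = mk⇔
    (λ (w , s) → proj₁ w , to (Sat-induced-extend ψ ρ w) s)
    (λ s → let (w , s′) = witness ψ ρ s in w , from (Sat-induced-extend ψ ρ w) s′)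

  induced-≡ₑ : N ≡ₑ M
  induced-≡ₑ φ = Sat-cong M φ (λ ()) ⇔-∘ Sat-induced φ noVars

data Tree : Set where
  lf : Tree
  nd : Tree → Tree → Tree

serialise : Tree → ℕᵇ → ℕᵇ
serialise lf       rest = 1+[2 rest ]
serialise (nd s t) rest = 2[1+ serialise s (serialise t rest) ]

serialise-injective : ∀ s t {r r′} → serialise s r ≡ serialise t r′ → s ≡ t × r ≡ r′
serialise-injective lf       lf       e = refl , 1+[2_]-injective e
serialise-injective lf       (nd _ _) ()
serialise-injective (nd _ _) lf       ()
serialise-injective (nd s₁ s₂) (nd t₁ t₂) e
  with refl , e₂ ← serialise-injective s₁ t₁ (2[1+_]-injective e)
  with refl , e₃ ← serialise-injective s₂ t₂ e₂
  = refl , e₃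

treeCode : Tree → ℕ
treeCode t = toℕ (serialise t 0ᵇ)

treeCode-injective : Injective _≡_ _≡_ treeCode
treeCode-injective e = proj₁ (serialise-injective _ _ (toℕ-injective e))

encodeℕ : ℕ → Tree
encodeℕ zero    = lf
encodeℕ (suc k) = nd lf (encodeℕ k)

decodeℕ : Tree → Maybe ℕ
decodeℕ lf       = just zero
decodeℕ (nd _ t) = Maybe.map suc (decodeℕ t)

decodeℕ-encodeℕ : ∀ k → decodeℕ (encodeℕ k) ≡ just k
decodeℕ-encodeℕ zero    = refl
decodeℕ-encodeℕ (suc k) = cong (Maybe.map suc) (decodeℕ-encodeℕ k)

encodeFin : ∀ {n} → Fin n → Tree
encodeFin Fin.zero    = lf
encodeFin (Fin.suc i) = nd lf (encodeFin i)

decodeFin : ∀ n → Tree → Maybe (Fin n)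
decodeFin zero    _        = nothing
decodeFin (suc n) lf       = just Fin.zero
decodeFin (suc n) (nd _ t) = Maybe.map Fin.suc (decodeFin n t)

decodeFin-encodeFin : ∀ {n} (i : Fin n) → decodeFin n (encodeFin i) ≡ just i
decodeFin-encodeFin Fin.zero    = refl
decodeFin-encodeFin (Fin.suc i) = cong (Maybe.map Fin.suc) (decodeFin-encodeFin i)

encodeFormula : ∀ {n} → Formula n → Tree
encodeFormula (rel i j)  = nd (encodeℕ 0) (nd (encodeFin i) (encodeFin j))
encodeFormula (eq i j)   = nd (encodeℕ 1) (nd (encodeFin i) (encodeFin j))
encodeFormula falsum     = nd (encodeℕ 2) lf
encodeFormula verum      = nd (encodeℕ 3) lf
encodeFormula (neg φ)    = nd (encodeℕ 4) (encodeFormula φ)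
encodeFormula (conj φ ψ) = nd (encodeℕ 5) (nd (encodeFormula φ) (encodeFormula ψ))
encodeFormula (disj φ ψ) = nd (encodeℕ 6) (nd (encodeFormula φ) (encodeFormula ψ))
encodeFormula (impl φ ψ) = nd (encodeℕ 7) (nd (encodeFormula φ) (encodeFormula ψ))
encodeFormula (all φ)    = nd (encodeℕ 8) (encodeFormula φ)
encodeFormula (ex φ)     = nd (encodeℕ 9) (encodeFormula φ)

decodeFormula : ∀ n → Tree → Maybe (Formula n)
decodeTagged : ∀ n → Maybe ℕ → Tree → Maybe (Formula n)

decodeFormula n lf         = nothing
decodeFormula n (nd tag t) = decodeTagged n (decodeℕ tag) t

decodeTagged n (just 0) (nd a b) = zipWith rel (decodeFin n a) (decodeFin n b)
decodeTagged n (just 1) (nd a b) = zipWith eq (decodeFin n a) (decodeFin n b)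
decodeTagged n (just 2) _        = just falsum
decodeTagged n (just 3) _        = just verum
decodeTagged n (just 4) a        = Maybe.map neg (decodeFormula n a)
decodeTagged n (just 5) (nd a b) = zipWith conj (decodeFormula n a) (decodeFormula n b)
decodeTagged n (just 6) (nd a b) = zipWith disj (decodeFormula n a) (decodeFormula n b)
decodeTagged n (just 7) (nd a b) = zipWith impl (decodeFormula n a) (decodeFormula n b)
decodeTagged n (just 8) a        = Maybe.map all (decodeFormula (suc n) a)
decodeTagged n (just 9) a        = Maybe.map ex (decodeFormula (suc n) a)
decodeTagged n _        _        = nothing

decodeFormula-encodeFormula : ∀ {n} (φ : Formula n) → decodeFormula n (encodeFormula φ) ≡ just φ
decodeFormula-encodeFormula (rel i j)  rewrite decodeFin-encodeFin i | decodeFin-encodeFin j = refl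
decodeFormula-encodeFormula (eq i j)   rewrite decodeFin-encodeFin i | decodeFin-encodeFin j = refl
decodeFormula-encodeFormula falsum     = refl
decodeFormula-encodeFormula verum      = refl
decodeFormula-encodeFormula (neg φ)    rewrite decodeFormula-encodeFormula φ = refl
decodeFormula-encodeFormula (conj φ ψ) rewrite decodeFormula-encodeFormula φ | decodeFormula-encodeFormula ψ = refl
decodeFormula-encodeFormula (disj φ ψ) rewrite decodeFormula-encodeFormula φ | decodeFormula-encodeFormula ψ = refl
decodeFormula-encodeFormula (impl φ ψ) rewrite decodeFormula-encodeFormula φ | decodeFormula-encodeFormula ψ = refl
decodeFormula-encodeFormula (all φ)    rewrite decodeFormula-encodeFormula φ = refl
decodeFormula-encodeFormula (ex φ)     rewrite decodeFormula-encodeFormula φ = refl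

CountableCarrier : Structure → Set
CountableCarrier M = Countable {Carrier M} (λ _ → ⊤)

countable-surjection : ExcludedMiddle → {A B : Set} (code : B → ℕ) → Injective _≡_ _≡_ code →
  (f : B → A) → (∀ a → ∃ λ b → f b ≡ a) → Countable {A} (λ _ → ⊤)
countable-surjection LEM {A} {B} code code-injective f f-onto = enumerate , enumerate-onto
  where
  enumerate : ℕ → Maybe A
  enumerate k = Maybe.map (f ∘ proj₁) (dec⇒maybe (decide LEM (∃ λ b → code b ≡ k)))

  enumerate-onto : (a : A) → ⊤ → ∃ λ k → enumerate k ≡ just a
  enumerate-onto a _ with (b , refl) ← f-onto a = code b , enumerate-code
    where
    enumerate-code : enumerate (code b) ≡ just (f b)
    enumerate-code with decide LEM (∃ λ b′ → code b′ ≡ code b)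
    ... | yes (b′ , c) = cong (just ∘ f) (code-injective c)
    ... | no ¬∃          = ⊥-elim (¬∃ (b , refl))

countable-separable : (M : Structure) → CountableCarrier M → Separable M
countable-separable M countable =
  (λ _ → ⊤) , countable , λ x y → x , tt , λ x≺y → inj₂ refl , inj₁ x≺y

skolemHead : (n : ℕ) → Formula (suc n) → Tree
skolemHead n ψ = nd (encodeℕ n) (encodeFormula ψ)

decodeSkolemHead : Tree → Maybe (Σ ℕ λ n → Formula (suc n))
decodeSkolemHead lf       = nothing
decodeSkolemHead (nd a b) = decodeℕ a >>= λ n → Maybe.map (n ,_) (decodeFormula (suc n) b)

decodeSkolemHead-skolemHead : ∀ n ψ → decodeSkolemHead (skolemHead n ψ) ≡ just (n , ψ)
decodeSkolemHead-skolemHead n ψ rewrite decodeℕ-encodeℕ n | decodeFormula-encodeFormula ψ = refl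

argumentList : ∀ {n} → (Fin n → Tree) → Tree
argumentList {zero}  τ = lf
argumentList {suc n} τ = nd (τ Fin.zero) (argumentList (τ ∘ Fin.suc))

-- The Skolem hull of a point d: trees are read as Skolem terms
-- nd (skolemHead n ψ) (argumentList τ), and ill-formed trees denote d.
module SkolemHull (LEM : ExcludedMiddle) (M : Structure) (d : Carrier M) where

  skolem : ∀ {n} → Formula (suc n) → (Fin n → Carrier M) → Carrier M
  skolem ψ σ = proj₁ (hilbertε LEM d λ a → Sat M (extend σ a) ψ)

  skolem-sound : ∀ {n} (ψ : Formula (suc n)) (σ : Fin n → Carrier M) →
    Σ (Carrier M) (λ a → Sat M (extend σ a) ψ) → Sat M (extend σ (skolem ψ σ)) ψ
  skolem-sound ψ σ = proj₂ (hilbertε LEM d λ a → Sat M (extend σ a) ψ)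

  eval : Tree → Carrier M
  evalApplication : Maybe (Σ ℕ λ n → Formula (suc n)) → Tree → Carrier M
  evalArguments : ∀ n → Tree → Fin n → Carrier M

  eval lf        = d
  eval (nd h ts) = evalApplication (decodeSkolemHead h) ts

  evalApplication nothing        ts = d
  evalApplication (just (n , ψ)) ts = skolem ψ (evalArguments n ts)

  evalArguments zero    _         = λ ()
  evalArguments (suc n) lf        = λ _ → d
  evalArguments (suc n) (nd t ts) = extend (evalArguments n ts) (eval t)

  evalArguments-argumentList : ∀ {n} (τ : Fin n → Tree) i →
    evalArguments n (argumentList τ) i ≡ eval (τ i)
  evalArguments-argumentList τ Fin.zero    = refl
  evalArguments-argumentList τ (Fin.suc i) = evalArguments-argumentList (τ ∘ Fin.suc) i

  eval-skolemTerm : ∀ {n} (ψ : Formula (suc n)) (τ : Fin n → Tree) →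
    eval (nd (skolemHead n ψ) (argumentList τ)) ≡ skolem ψ (evalArguments n (argumentList τ))
  eval-skolemTerm {n} ψ τ rewrite decodeSkolemHead-skolemHead n ψ = refl

  InHull : Carrier M → Set
  InHull a = True (decide LEM (∃ λ t → eval t ≡ a))

  Hull : Structure
  Hull = induced M InHull

  hullElement : Tree → Carrier Hull
  hullElement t = eval t , fromWitness (t , refl)

  hull-tarskiVaught : TarskiVaught M InHull
  hull-tarskiVaught {n} ψ ρ (a , ψa) = hullElement t , to (Sat-cong M ψ values-agree) ψ-skolem
    where
    τ : Fin n → Tree
    τ i = proj₁ (toWitness (proj₂ (ρ i)))
    t = nd (skolemHead n ψ) (argumentList τ)
    arguments-agree : ∀ i → evalArguments n (argumentList τ) i ≡ proj₁ (ρ i)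
    arguments-agree i =
      trans (evalArguments-argumentList τ i) (proj₂ (toWitness (proj₂ (ρ i))))
    values-agree = extend-cong arguments-agree (sym (eval-skolemTerm ψ τ))
    ψ-skolem : Sat M (extend (evalArguments n (argumentList τ)) (skolem ψ _)) ψ
    ψ-skolem = skolem-sound ψ _
      (a , from (Sat-cong M ψ (extend-cong arguments-agree (refl {x = a}))) ψa)

  hull-countable : CountableCarrier Hull
  hull-countable = countable-surjection LEM treeCode treeCode-injective hullElement
    λ (a , a∈hull) → let (t , t↦a) = toWitness a∈hull in
      t , Σ-≡,≡→≡ (t↦a , T-irrelevant _ _)

  hull-≡ₑ : Hull ≡ₑ M
  hull-≡ₑ = induced-≡ₑ LEM T-irrelevant hull-tarskiVaught

downward-löwenheimSkolem : ExcludedMiddle → (M : Structure) →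
  Σ Structure λ N → CountableCarrier N × N ≡ₑ M
downward-löwenheimSkolem LEM M with LEM (Carrier M)
... | inj₁ d     = Hull , hull-countable , hull-≡ₑ
  where open SkolemHull LEM M d
... | inj₂ empty = M , ((λ _ → nothing) , λ a _ → ⊥-elim (empty a)) , λ _ → ⇔-id _

mainTheorem3 : ExcludedMiddle → (T : Theory) → (φ : Sentence) → Universal φ →
    (((M : Structure) → Mod T M → Separable M → M ⊨ φ) ⇔ ((M : Structure) → Mod T M → M ⊨ φ))
mainTheorem3 LEM T φ _ = mk⇔ fromSeparable (λ φ-in-models M M⊨T _ → φ-in-models M M⊨T)
  where
  fromSeparable : ((M : Structure) → Mod T M → Separable M → M ⊨ φ) →
    (M : Structure) → Mod T M → M ⊨ φ
  fromSeparable φ-in-separable M M⊨T =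
    let (N , N-countable , N≡ₑM) = downward-löwenheimSkolem LEM M
        N⊨T = λ ψ Tψ → from (N≡ₑM ψ) (M⊨T ψ Tψ)
    in to (N≡ₑM φ) (φ-in-separable N N⊨T (countable-separable N N-countable))
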